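{- Suppose $4\leq n+1\leq \ell$ and $1\leq t\leq n-2$. Let $f'=q^{\ell(n-t-1)+1}\theta_{n-t-1}-q^{\ell(n-t-2)+3}{n-t-1\brack 2}$, and let $h_0=q^{\ell(n-t-1)}\theta_{t+2}-q^{\ell(n-t-2)+1}\theta_{t+1}$ and $h_1=q^{\ell(n-t-1)+t+1}$ (these are the sizes of $\{F\in{V\brack n,0}:\dim(F\cap Z)\ge t+1\}$ for $Z$ a $(t+2,0)$-subspace, respectively a $(t+2,1)$-subspace, of $V$). Then: (i) if $1\leq t\leq\frac{n}{2}-\frac{3}{2}$, then $h_0<f'$; (ii) if $t=\frac{n}{2}-1$, then $h_0>f'>h_1$; (iii) if $\frac{n}{2}-\frac{1}{2}\leq t\leq n-2$, then $h_1>f'$.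
   Context: $q$ is a prime power. ${a\brack b}=\prod_{0\le i<b}\frac{q^{a-i}-1}{q^{b-i}-1}$ is the Gaussian binomial and $\theta_a={a\brack 1}=\frac{q^a-1}{q-1}$. $V$ is an $(n+\ell)$-dimensional vector space over $\mathbb{F}_q$ with a fixed $\ell$-dimensional subspace $W$; a subspace has type $(m,s)$ if it has dimension $m$ and meets $W$ in dimension $s$, and ${V\brack n,0}$ is the set of $(n,0)$-subspaces. -}

module Defs where

open import Data.Nat using (ℕ; zero; suc; _+_; _*_; _∸_; _^_; _≤_)
open import Data.Nat.DivMod using (_/_)
open import Data.Nat.Primality using (Prime)
open import Data.Product using (Σ; _×_)
open import Relation.Binary.PropositionalEquality using (_≡_)
open import Data.Integer as ℤ using (ℤ; +_)

IsPrimePower : ℕ → Set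
IsPrimePower q = Σ ℕ λ p → Σ ℕ λ k → Prime p × 1 ≤ k × q ≡ p ^ k

-- total division on ℕ (division by 0 yields 0; never used with d = 0 here)
div : ℕ → ℕ → ℕ
div m zero    = 0
div m (suc d) = m / suc d

prodTo : ℕ → (ℕ → ℕ) → ℕ
prodTo zero    f = 1
prodTo (suc b) f = prodTo b f * f b

gauss : ℕ → ℕ → ℕ → ℕ
gauss q a b = div (prodTo b (λ i → q ^ (a ∸ i) ∸ 1))
                  (prodTo b (λ i → q ^ (b ∸ i) ∸ 1))

θ : ℕ → ℕ → ℕ
θ q a = gauss q a 1

f′ : ℕ → ℕ → ℕ → ℕ → ℤ
f′ q n ℓ t = + (q ^ (ℓ * (n ∸ t ∸ 1) + 1) * θ q (n ∸ t ∸ 1))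
         ℤ.- + (q ^ (ℓ * (n ∸ t ∸ 2) + 3) * gauss q (n ∸ t ∸ 1) 2)

h₀ : ℕ → ℕ → ℕ → ℕ → ℤ
h₀ q n ℓ t = + (q ^ (ℓ * (n ∸ t ∸ 1)) * θ q (t + 2))
         ℤ.- + (q ^ (ℓ * (n ∸ t ∸ 2) + 1) * θ q (t + 1))

h₁ : ℕ → ℕ → ℕ → ℕ → ℤ
h₁ q n ℓ t = + (q ^ (ℓ * (n ∸ t ∸ 1) + t + 1))

module Submission where

-- Write n = t + 2 + k and θ_a = 1 + q + ⋯ + q^(a-1). Each of f′, h₀, h₁ is q^(ℓk) times a
-- difference of natural numbers, so every claim becomes an inequality in ℕ with the
-- subtracted terms moved across. Besides θ_a < q^a, θ_(a+1) = 1 + q θ_a = θ_a + q^a and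
-- q ≥ 2, the only estimate needed is q³ [a+1, 2] < q^(ℓ+1) θ_a for 1 ≤ a and a + 3 ≤ ℓ:
-- (q + 1) [a+1, 2] ≤ θ_(a+1) θ_a and q² θ_(a+1) < q^(a+3) ≤ q^ℓ.

open import Defs
open import Data.Nat using (ℕ; zero; suc; _+_; _*_; _∸_; _^_; _≤_; _<_; NonZero; z≤n; s≤s; >-nonZero)
open import Data.Nat.Properties
open import Data.Nat.DivMod using (m*n/n≡m; m/n*n≤m)
open import Data.Nat.Primality using (prime⇒nonTrivial)
open import Data.Nat.Base using (nonTrivial⇒n>1)
open import Data.Nat.Tactic.RingSolver using (solve-∀)
open import Data.Integer as ℤ using (+_; _⊖_; +<+; _>_)
import Data.Integer.Properties as ℤ
open import Data.Product using (_×_; _,_)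
open import Function using (_∘_)
open import Relation.Binary.PropositionalEquality using (_≡_; refl; sym; trans; cong; cong₂; subst; subst₂; module ≡-Reasoning)

repunit : ℕ → ℕ → ℕ
repunit q zero    = 0
repunit q (suc a) = 1 + q * repunit q a

repunit-suc : ∀ q a → repunit q (suc a) ≡ repunit q a + q ^ a
repunit-suc q zero    = cong suc (*-zeroʳ q)
repunit-suc q (suc a) = begin
  1 + q * repunit q (suc a)        ≡⟨ cong (λ s → 1 + q * s) (repunit-suc q a) ⟩
  1 + q * (repunit q a + q ^ a)    ≡⟨ regroup q (repunit q a) (q ^ a) ⟩
  repunit q (suc a) + q * q ^ a    ∎
  where open ≡-Reasoning
        regroup : ∀ q s x → 1 + q * (s + x) ≡ (1 + q * s) + q * x
        regroup = solve-∀

repunit*pred+1≡^ : ∀ p a → repunit (suc p) a * p + 1 ≡ suc p ^ a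
repunit*pred+1≡^ p zero    = refl
repunit*pred+1≡^ p (suc a) = begin
  (1 + suc p * r) * p + 1  ≡⟨ regroup p r ⟩
  suc p * (r * p + 1)      ≡⟨ cong (suc p *_) (repunit*pred+1≡^ p a) ⟩
  suc p * suc p ^ a        ∎
  where open ≡-Reasoning
        r : ℕ
        r = repunit (suc p) a
        regroup : ∀ p r → (1 + suc p * r) * p + 1 ≡ suc p * (r * p + 1)
        regroup = solve-∀

^∸1≡repunit*pred : ∀ p a → suc p ^ a ∸ 1 ≡ repunit (suc p) a * p
^∸1≡repunit*pred p a = trans (cong (_∸ 1) (sym (repunit*pred+1≡^ p a))) (m+n∸n≡m _ 1)

repunit-mono-≤ : ∀ q {a b} → a ≤ b → repunit q a ≤ repunit q b
repunit-mono-≤ q z≤n       = z≤n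
repunit-mono-≤ q (s≤s a≤b) = s≤s (*-monoʳ-≤ q (repunit-mono-≤ q a≤b))

repunit<^ : ∀ {q} → 1 < q → ∀ a → repunit q a < q ^ a
repunit<^ q>1 zero    = s≤s z≤n
repunit<^ {q} q>1 (suc a) = begin-strict
  1 + q * repunit q a  <⟨ +-monoˡ-< (q * repunit q a) q>1 ⟩
  q + q * repunit q a  ≡⟨ *-suc q (repunit q a) ⟨
  q * suc (repunit q a) ≤⟨ *-monoʳ-≤ q (repunit<^ q>1 a) ⟩
  q * q ^ a            ∎
  where open ≤-Reasoning

θ≡repunit : ∀ {q} → 1 < q → ∀ a → θ q a ≡ repunit q a
θ≡repunit {suc (suc r)} (s≤s (s≤s z≤n)) a = trans
  (cong₂ div (trans (*-identityˡ _) (^∸1≡repunit*pred (suc r) a))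
             (trans (*-identityˡ _) (cong (_∸ 1) (*-identityʳ (2 + r)))))
  (m*n/n≡m (repunit (2 + r) a) (suc r))

div*≤ : ∀ m d → div m d * d ≤ m
div*≤ m zero    = z≤n
div*≤ m (suc d) = m/n*n≤m m (suc d)

-- Only an upper bound, because gauss is defined by truncating division.
gauss₂*[q+1]≤repunit*repunit : ∀ {q} → 1 < q → ∀ m →
  gauss q (suc m) 2 * (q + 1) ≤ repunit q (suc m) * repunit q m
gauss₂*[q+1]≤repunit*repunit {q@(suc (suc r))} (s≤s (s≤s z≤n)) m = *-cancelʳ-≤ _ _ (p * p) (begin
  G * (q + 1) * (p * p)                     ≡⟨ expand G r ⟩
  G * (1 * (repunit q 2 * p) * (repunit q 1 * p))
    ≡⟨ cong (λ d → G * d) (cong₂ (λ x y → 1 * x * y) (^∸1≡repunit*pred p 2) (^∸1≡repunit*pred p 1)) ⟨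
  G * (1 * (q ^ 2 ∸ 1) * (q ^ 1 ∸ 1))       ≤⟨ div*≤ (1 * (q ^ suc m ∸ 1) * (q ^ m ∸ 1)) (1 * (q ^ 2 ∸ 1) * (q ^ 1 ∸ 1)) ⟩
  1 * (q ^ suc m ∸ 1) * (q ^ m ∸ 1)
    ≡⟨ cong₂ (λ x y → 1 * x * y) (^∸1≡repunit*pred p (suc m)) (^∸1≡repunit*pred p m) ⟩
  1 * (repunit q (suc m) * p) * (repunit q m * p) ≡⟨ regroup (repunit q (suc m)) (repunit q m) p ⟩
  repunit q (suc m) * repunit q m * (p * p) ∎)
  where open ≤-Reasoning
        p G : ℕ
        p = suc r
        G = gauss q (suc m) 2
        -- the two factors on the right are repunit q 2 and repunit q 1, unfolded
        expand : ∀ g r → g * (2 + r + 1) * (suc r * suc r)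
                       ≡ g * (1 * ((1 + (2 + r) * (1 + (2 + r) * 0)) * suc r) * ((1 + (2 + r) * 0) * suc r))
        expand = solve-∀
        regroup : ∀ a b p → 1 * (a * p) * (b * p) ≡ a * b * (p * p)
        regroup = solve-∀

m⊖n<o⊖p : ∀ m n o p → m + p < o + n → m ⊖ n ℤ.< o ⊖ p
m⊖n<o⊖p m n o p m+p<o+n = begin-strict
  m ⊖ n                  ≡⟨ ℤ.+-cancelˡ-⊖ p m n ⟨
  (p + m) ⊖ (p + n)      <⟨ ℤ.⊖-monoˡ-< (p + n) p+m<n+o ⟩
  (n + o) ⊖ (p + n)      ≡⟨ cong ((n + o) ⊖_) (+-comm p n) ⟩
  (n + o) ⊖ (n + p)      ≡⟨ ℤ.+-cancelˡ-⊖ n o p ⟩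
  o ⊖ p                  ∎
  where open ℤ.≤-Reasoning
        p+m<n+o : p + m < n + o
        p+m<n+o = subst₂ _<_ (+-comm m p) (+-comm o n) m+p<o+n

m-n≡o⊖p : ∀ {m n o p} → m ≡ o → n ≡ p → + m ℤ.- + n ≡ o ⊖ p
m-n≡o⊖p {m} {n} refl refl = ℤ.m-n≡m⊖n m n

m<n⊖o : ∀ m n o → m + o < n → + m ℤ.< n ⊖ o
m<n⊖o m n o m+o<n = m⊖n<o⊖p m 0 n o (subst (m + o <_) (sym (+-identityʳ n)) m+o<n)

m⊖n<o : ∀ m n o → m < o → m ⊖ n ℤ.< + o
m⊖n<o m n o m<o = ℤ.≤-<-trans (ℤ.m⊖n≤m m n) (+<+ m<o)

module _ {q : ℕ} (q>1 : 1 < q) where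

  private instance
    q≢0 : NonZero q
    q≢0 = >-nonZero (≤-trans (s≤s z≤n) q>1)

  q³*gauss₂<q^ℓ*q*repunit : ∀ m ℓ → 1 + m + 3 ≤ ℓ →
    q ^ 3 * gauss q (2 + m) 2 < q ^ ℓ * q * repunit q (1 + m)
  q³*gauss₂<q^ℓ*q*repunit m ℓ 1+m+3≤ℓ = *-cancelʳ-< (q + 1) _ _ (begin-strict
    q ^ 3 * G * (q + 1)          ≡⟨ *-assoc (q ^ 3) G (q + 1) ⟩
    q ^ 3 * (G * (q + 1))        ≤⟨ *-monoʳ-≤ (q ^ 3) (gauss₂*[q+1]≤repunit*repunit q>1 (1 + m)) ⟩
    q ^ 3 * (R₂ * R₁)            ≡⟨ regroup q R₂ R₁ ⟩
    q * q * R₂ * (q * R₁)        <⟨ *-monoˡ-< (q * R₁) {{m*n≢0 q R₁}} q²R₂<q^ℓ ⟩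
    q ^ ℓ * (q * R₁)             ≤⟨ m≤m*n (q ^ ℓ * (q * R₁)) (q + 1) {{q+1≢0}} ⟩
    q ^ ℓ * (q * R₁) * (q + 1)   ≡⟨ cong (_* (q + 1)) (*-assoc (q ^ ℓ) q R₁) ⟨
    q ^ ℓ * q * R₁ * (q + 1)     ∎)
    where
    open ≤-Reasoning
    G R₁ R₂ : ℕ
    G  = gauss q (2 + m) 2
    R₁ = repunit q (1 + m)
    R₂ = repunit q (2 + m)
    q+1≢0 : NonZero (q + 1)
    q+1≢0 = >-nonZero (m≤n+m 1 q)
    regroup : ∀ q a b → q * (q * (q * 1)) * (a * b) ≡ q * q * a * (q * b)
    regroup = solve-∀
    q²R₂<q^ℓ : q * q * R₂ < q ^ ℓ
    q²R₂<q^ℓ = begin-strict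
      q * q * R₂             <⟨ *-monoʳ-< (q * q) {{m*n≢0 q q}} (repunit<^ q>1 (2 + m)) ⟩
      q * q * q ^ (2 + m)    ≡⟨ *-assoc q q (q ^ (2 + m)) ⟩
      q ^ (4 + m)            ≤⟨ ^-monoʳ-≤ q (subst (_≤ ℓ) (cong suc (+-comm m 3)) 1+m+3≤ℓ) ⟩
      q ^ ℓ                  ∎

  q³*gauss₂<q^ℓ*repunit : ∀ m ℓ → 1 + m + 3 ≤ ℓ →
    q ^ 3 * gauss q (2 + m) 2 < q ^ ℓ * repunit q (2 + m)
  q³*gauss₂<q^ℓ*repunit m ℓ 1+m+3≤ℓ = begin-strict
    q ^ 3 * gauss q (2 + m) 2        <⟨ q³*gauss₂<q^ℓ*q*repunit m ℓ 1+m+3≤ℓ ⟩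
    q ^ ℓ * q * repunit q (1 + m)    ≡⟨ *-assoc (q ^ ℓ) q _ ⟩
    q ^ ℓ * (q * repunit q (1 + m))  <⟨ *-monoʳ-< (q ^ ℓ) {{m^n≢0 q ℓ}} (n<1+n _) ⟩
    q ^ ℓ * repunit q (2 + m)        ∎
    where open ≤-Reasoning

  -- The comparisons of the theorem for n = t + 2 + k, divided by q^(ℓk), with subtracted
  -- terms moved to the other side.
  h₀<f′-cleared : ∀ {t k ℓ} → 1 + t ≤ k → k + 3 ≤ ℓ →
    q ^ ℓ * repunit q (2 + t) + q ^ 3 * gauss q (1 + k) 2 < q ^ ℓ * q * repunit q (1 + k) + q * repunit q (1 + t)
  h₀<f′-cleared {t} {suc m} {ℓ} (s≤s t≤m) k+3≤ℓ = begin-strict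
    Y * repunit q (2 + t) + q ^ 3 * gauss q (2 + m) 2
      <⟨ +-monoʳ-< (Y * repunit q (2 + t)) (q³*gauss₂<q^ℓ*repunit m ℓ k+3≤ℓ) ⟩
    Y * repunit q (2 + t) + Y * R
      ≤⟨ +-monoˡ-≤ (Y * R) (*-monoʳ-≤ Y (repunit-mono-≤ q (s≤s (s≤s t≤m)))) ⟩
    Y * R + Y * R                  ≡⟨ double (Y * R) ⟩
    2 * (Y * R)                    ≤⟨ *-monoˡ-≤ (Y * R) q>1 ⟩
    q * (Y * R)                    ≡⟨ swap q Y R ⟩
    Y * q * R                      ≤⟨ m≤m+n (Y * q * R) _ ⟩
    Y * q * R + q * repunit q (1 + t) ∎
    where
    open ≤-Reasoning
    Y R : ℕ
    Y = q ^ ℓ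
    R = repunit q (2 + m)
    double : ∀ x → x + x ≡ 2 * x
    double = solve-∀
    swap : ∀ q y r → q * (y * r) ≡ y * q * r
    swap = solve-∀

  f′<h₀-cleared : ∀ {t ℓ} → 2 + t ≤ ℓ →
    q ^ ℓ * q * repunit q (1 + t) + q * repunit q (1 + t) < q ^ ℓ * repunit q (2 + t) + q ^ 3 * gauss q (1 + t) 2
  f′<h₀-cleared {t} {ℓ} 2+t≤ℓ = begin-strict
    Y * q * R + q * R      <⟨ +-monoʳ-< (Y * q * R) qR<Y ⟩
    Y * q * R + Y          ≡⟨ regroup Y q R ⟩
    Y * (1 + q * R)        ≤⟨ m≤m+n (Y * (1 + q * R)) _ ⟩
    Y * repunit q (2 + t) + q ^ 3 * gauss q (1 + t) 2 ∎
    where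
    open ≤-Reasoning
    Y R : ℕ
    Y = q ^ ℓ
    R = repunit q (1 + t)
    regroup : ∀ y q r → y * q * r + y ≡ y * (1 + q * r)
    regroup = solve-∀
    qR<Y : q * R < Y
    qR<Y = <-≤-trans (*-monoʳ-< q (repunit<^ q>1 (1 + t))) (^-monoʳ-≤ q 2+t≤ℓ)

  h₁<f′-cleared : ∀ {t ℓ} → 1 ≤ t → t + 3 ≤ ℓ →
    q ^ ℓ * q ^ (1 + t) + q ^ 3 * gauss q (1 + t) 2 < q ^ ℓ * q * repunit q (1 + t)
  h₁<f′-cleared {suc m} {ℓ} _ t+3≤ℓ = begin-strict
    Y * q ^ (2 + m) + q ^ 3 * gauss q (2 + m) 2
      <⟨ +-monoʳ-< (Y * q ^ (2 + m)) (q³*gauss₂<q^ℓ*q*repunit m ℓ t+3≤ℓ) ⟩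
    Y * q ^ (2 + m) + Y * q * repunit q (1 + m)   ≡⟨ regroup Y q (q ^ (1 + m)) (repunit q (1 + m)) ⟩
    Y * q * (repunit q (1 + m) + q ^ (1 + m))     ≡⟨ cong (Y * q *_) (repunit-suc q (1 + m)) ⟨
    Y * q * repunit q (2 + m)                     ∎
    where
    open ≤-Reasoning
    Y : ℕ
    Y = q ^ ℓ
    regroup : ∀ y q x r → y * (q * x) + y * q * r ≡ y * q * (r + x)
    regroup = solve-∀

  f′<h₁-cleared : ∀ {k t} ℓ → 1 + k ≤ t → q ^ ℓ * q * repunit q (1 + k) < q ^ ℓ * q ^ (1 + t)
  f′<h₁-cleared {k} {t} ℓ 1+k≤t = begin-strict
    q ^ ℓ * q * repunit q (1 + k)    ≡⟨ *-assoc (q ^ ℓ) q _ ⟩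
    q ^ ℓ * (q * repunit q (1 + k))  <⟨ *-monoʳ-< (q ^ ℓ) {{m^n≢0 q ℓ}} (*-monoʳ-< q R<q^t) ⟩
    q ^ ℓ * q ^ (1 + t)              ∎
    where
    open ≤-Reasoning
    R<q^t : repunit q (1 + k) < q ^ t
    R<q^t = <-≤-trans (repunit<^ q>1 (1 + k)) (^-monoʳ-≤ q 1+k≤t)

  module _ (ℓ t k : ℕ) where

    X F⁺ F⁻ H₀⁺ H₀⁻ H₁ : ℕ
    X   = q ^ (ℓ * k)
    F⁺  = q ^ ℓ * q * repunit q (1 + k)
    F⁻  = q ^ 3 * gauss q (1 + k) 2
    H₀⁺ = q ^ ℓ * repunit q (2 + t)
    H₀⁻ = q * repunit q (1 + t)
    H₁  = q ^ ℓ * q ^ (1 + t)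

    private
      n∸t≡2+k : t + 2 + k ∸ t ≡ 2 + k
      n∸t≡2+k = trans (cong (_∸ t) (+-assoc t 2 k)) (m+n∸m≡n t (2 + k))

      q^ℓ[1+k] : q ^ (ℓ * suc k) ≡ q ^ ℓ * X
      q^ℓ[1+k] = trans (cong (q ^_) (*-suc ℓ k)) (^-distribˡ-+-* q ℓ (ℓ * k))

      X*-mono-< : ∀ {a b} → a < b → X * a < X * b
      X*-mono-< = *-monoʳ-< X {{m^n≢0 q (ℓ * k)}}

      X*-mono-<-+ : ∀ {a b c d} → a + d < c + b → X * a + X * d < X * c + X * b
      X*-mono-<-+ {a} {b} {c} {d} = subst₂ _<_ (*-distribˡ-+ X a d) (*-distribˡ-+ X c b) ∘ X*-mono-<

    f′≡ : f′ q (t + 2 + k) ℓ t ≡ X * F⁺ ⊖ X * F⁻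
    f′≡ rewrite n∸t≡2+k = m-n≡o⊖p positive negative
      where
      positive : q ^ (ℓ * suc k + 1) * θ q (suc k) ≡ X * F⁺
      positive rewrite ^-distribˡ-+-* q (ℓ * suc k) 1 | q^ℓ[1+k] | θ≡repunit q>1 (suc k) = regroup (q ^ ℓ) X q _
        where regroup : ∀ y x q r → y * x * (q * 1) * r ≡ x * (y * q * r)
              regroup = solve-∀
      negative : q ^ (ℓ * k + 3) * gauss q (suc k) 2 ≡ X * F⁻
      negative rewrite ^-distribˡ-+-* q (ℓ * k) 3 = *-assoc X (q ^ 3) _

    h₀≡ : h₀ q (t + 2 + k) ℓ t ≡ X * H₀⁺ ⊖ X * H₀⁻
    h₀≡ rewrite n∸t≡2+k = m-n≡o⊖p positive negative
      where
      positive : q ^ (ℓ * suc k) * θ q (t + 2) ≡ X * H₀⁺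
      positive rewrite q^ℓ[1+k] | θ≡repunit q>1 (t + 2) | +-comm t 2 = regroup (q ^ ℓ) X _
        where regroup : ∀ y x r → y * x * r ≡ x * (y * r)
              regroup = solve-∀
      negative : q ^ (ℓ * k + 1) * θ q (t + 1) ≡ X * H₀⁻
      negative rewrite ^-distribˡ-+-* q (ℓ * k) 1 | θ≡repunit q>1 (t + 1) | +-comm t 1 = regroup X q _
        where regroup : ∀ x q r → x * (q * 1) * r ≡ x * (q * r)
              regroup = solve-∀

    h₁≡ : h₁ q (t + 2 + k) ℓ t ≡ + (X * H₁)
    h₁≡ rewrite n∸t≡2+k = cong +_ (begin
      q ^ (ℓ * suc k + t + 1)         ≡⟨ cong (q ^_) (trans (+-assoc (ℓ * suc k) t 1) (cong (λ e → ℓ * suc k + e) (+-comm t 1))) ⟩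
      q ^ (ℓ * suc k + (1 + t))       ≡⟨ ^-distribˡ-+-* q (ℓ * suc k) (1 + t) ⟩
      q ^ (ℓ * suc k) * q ^ (1 + t)   ≡⟨ cong (_* q ^ (1 + t)) q^ℓ[1+k] ⟩
      q ^ ℓ * X * q ^ (1 + t)         ≡⟨ regroup (q ^ ℓ) X _ ⟩
      X * H₁                          ∎)
      where
      open ≡-Reasoning
      regroup : ∀ y x r → y * x * r ≡ x * (y * r)
      regroup = solve-∀

    private
      k+3≤ℓ : t + 2 + k + 1 ≤ ℓ → k + 3 ≤ ℓ
      k+3≤ℓ = ≤-trans (subst (k + 3 ≤_) (regroup t k) (m≤n+m (k + 3) t))
        where regroup : ∀ t k → t + (k + 3) ≡ t + 2 + k + 1
              regroup = solve-∀

      t≡k : 2 * t + 2 ≡ t + 2 + k → t ≡ k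
      t≡k 2t+2≡n = +-cancelˡ-≡ (t + 2) t k (trans (regroup t) 2t+2≡n)
        where regroup : ∀ t → t + 2 + t ≡ 2 * t + 2
              regroup = solve-∀

    h₀<f′ : t + 2 + k + 1 ≤ ℓ → 2 * t + 3 ≤ t + 2 + k → h₀ q (t + 2 + k) ℓ t ℤ.< f′ q (t + 2 + k) ℓ t
    h₀<f′ n+1≤ℓ 2t+3≤n rewrite h₀≡ | f′≡ =
      m⊖n<o⊖p (X * H₀⁺) (X * H₀⁻) (X * F⁺) (X * F⁻) (X*-mono-<-+ (h₀<f′-cleared 1+t≤k (k+3≤ℓ n+1≤ℓ)))
      where
      regroup : ∀ t → 2 * t + 3 ≡ t + 2 + (1 + t)
      regroup = solve-∀
      1+t≤k : 1 + t ≤ k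
      1+t≤k = +-cancelˡ-≤ (t + 2) _ _ (subst (_≤ t + 2 + k) (regroup t) 2t+3≤n)

    f′<h₀×h₁<f′ : t + 2 + k + 1 ≤ ℓ → 1 ≤ t → 2 * t + 2 ≡ t + 2 + k →
      f′ q (t + 2 + k) ℓ t ℤ.< h₀ q (t + 2 + k) ℓ t × h₁ q (t + 2 + k) ℓ t ℤ.< f′ q (t + 2 + k) ℓ t
    f′<h₀×h₁<f′ n+1≤ℓ 1≤t 2t+2≡n with t≡k 2t+2≡n
    ... | refl rewrite f′≡ | h₀≡ | h₁≡ =
        m⊖n<o⊖p (X * F⁺) (X * F⁻) (X * H₀⁺) (X * H₀⁻) (X*-mono-<-+ (f′<h₀-cleared 2+t≤ℓ))
      , m<n⊖o (X * H₁) (X * F⁺) (X * F⁻)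
          (subst (_< X * F⁺) (*-distribˡ-+ X H₁ F⁻) (X*-mono-< (h₁<f′-cleared 1≤t (k+3≤ℓ n+1≤ℓ))))
      where
      2+t≤ℓ : 2 + t ≤ ℓ
      2+t≤ℓ = ≤-trans (n≤1+n (2 + t)) (subst (_≤ ℓ) (+-comm t 3) (k+3≤ℓ n+1≤ℓ))

    f′<h₁ : t + 2 + k ≤ 2 * t + 1 → f′ q (t + 2 + k) ℓ t ℤ.< h₁ q (t + 2 + k) ℓ t
    f′<h₁ n≤2t+1 rewrite f′≡ | h₁≡ = m⊖n<o (X * F⁺) (X * F⁻) (X * H₁) (X*-mono-< (f′<h₁-cleared ℓ 1+k≤t))
      where
      regroup : ∀ t k → t + 2 + k ≡ t + 1 + (1 + k)
      regroup = solve-∀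
      regroup′ : ∀ t → 2 * t + 1 ≡ t + 1 + t
      regroup′ = solve-∀
      1+k≤t : 1 + k ≤ t
      1+k≤t = +-cancelˡ-≤ (t + 1) _ _ (subst₂ _≤_ (regroup t k) (regroup′ t) n≤2t+1)

IsPrimePower⇒1< : ∀ {q} → IsPrimePower q → 1 < q
IsPrimePower⇒1< (p , k , p-prime , 1≤k , refl) =
  ^-monoʳ-< p (nonTrivial⇒n>1 p {{prime⇒nonTrivial p-prime}}) 1≤k

-- The hypothesis 4 ≤ n + 1 follows from 1 ≤ t and t + 2 ≤ n.
lemma3p3 : (q n ℓ t : ℕ) → IsPrimePower q →
    4 ≤ n + 1 → n + 1 ≤ ℓ → 1 ≤ t → t + 2 ≤ n →
    ((2 * t + 3 ≤ n → h₀ q n ℓ t ℤ.< f′ q n ℓ t) ×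
     (2 * t + 2 ≡ n → (h₀ q n ℓ t > f′ q n ℓ t × f′ q n ℓ t > h₁ q n ℓ t)) ×
     (n ≤ 2 * t + 1 → h₁ q n ℓ t > f′ q n ℓ t))
lemma3p3 q n ℓ t q-primePower _ n+1≤ℓ 1≤t t+2≤n with m≤n⇒∃[o]m+o≡n t+2≤n
... | k , refl = h₀<f′ q>1 ℓ t k n+1≤ℓ , f′<h₀×h₁<f′ q>1 ℓ t k n+1≤ℓ 1≤t , f′<h₁ q>1 ℓ t k
  where q>1 : 1 < q
        q>1 = IsPrimePower⇒1< q-primePower
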